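{- Let \[ S(x,y,z) = \frac{1}{1 - (x+y+z) + \frac{3}{4}(xy+yz+zx)} \] and for $n \ge 0$ let $s_n$ denote the coefficient of $(xyz)^n$ in the Taylor expansion of $S(2x,2y,2z)$ at the origin (so $s_0, s_1, s_2, \dots = 1, 12, 198, 3720, \dots$). Then $s_n > 0$ for all $n \ge 0$. -}

module Defs where

open import Data.Nat using (ℕ; zero; suc)
open import Data.Integer using (ℤ; +_; _+_; _-_; _*_)

-- coeff a b c = coefficient of x^a y^b z^c in the Taylor expansion at the origin of
--   S(2x,2y,2z) = 1 / (1 - 2(x+y+z) + 3(xy+yz+zx)).
-- Defined by the identity  S(2x,2y,2z) * (1 - 2(x+y+z) + 3(xy+yz+zx)) = 1,
-- i.e. c(a,b,c) = [a=b=c=0] + 2(c(a-1,b,c)+c(a,b-1,c)+c(a,b,c-1))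
--                 - 3(c(a-1,b-1,c)+c(a,b-1,c-1)+c(a-1,b,c-1)),
-- with coefficients at negative indices equal to 0.
coeff : ℕ → ℕ → ℕ → ℤ
coeff zero    zero    zero    = + 1
coeff (suc a) zero    zero    = + 2 * coeff a zero zero
coeff zero    (suc b) zero    = + 2 * coeff zero b zero
coeff zero    zero    (suc c) = + 2 * coeff zero zero c
coeff (suc a) (suc b) zero    =
  + 2 * (coeff a (suc b) zero + coeff (suc a) b zero) - + 3 * coeff a b zero
coeff (suc a) zero    (suc c) =
  + 2 * (coeff a zero (suc c) + coeff (suc a) zero c) - + 3 * coeff a zero c
coeff zero    (suc b) (suc c) =
  + 2 * (coeff zero b (suc c) + coeff zero (suc b) c) - + 3 * coeff zero b c
coeff (suc a) (suc b) (suc c) =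
  + 2 * (coeff a (suc b) (suc c) + coeff (suc a) b (suc c) + coeff (suc a) (suc b) c)
  - + 3 * (coeff a b (suc c) + coeff (suc a) b c + coeff a (suc b) c)

s : ℕ → ℤ
s n = coeff n n n

-- S = 1/Q with Q = 1 - 2(x+y+z) + 3(xy+yz+zx) is the series S(2x,2y,2z) of the statement.
-- Its coefficients satisfy the linear relations Q·S = 1 and Q·S² = S, Euler's identity
-- x ∂S/∂x = -x (∂Q/∂x) S², and the symmetry of S and S² under permutations of x, y, z.
-- A finite combination of shifts of these relations, with coefficients polynomial in n,
-- yields the recurrence
--   2n² s(n) = 3(27n² - 27n + 8) s(n-1) - 81(3n-2)(3n-4) s(n-2).
-- For g(n) = 2 s(n+1) - 27 s(n) it reads
--   (n+3)² g(n+2) = (27n+57) s(n+2) + 3(3n+7)(3n+5) g(n+1),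
-- whose coefficients are positive, so s(1) = 12 > 0 and g(1) = 72 ≥ 0 propagate to
-- s(n) > 0 and g(n) ≥ 0 for all n ≥ 1.

module Submission where

open import Defs
open import Data.Nat as ℕ using (ℕ; zero; suc; z≤n; z<s; _⊓_; _⊔_)
import Data.Nat.Properties as ℕ
open import Data.Integer as ℤ
  using (ℤ; +_; -[1+_]; 0ℤ; -1ℤ; _+_; _-_; _*_; -_; pred; _≤_; _<_; +≤+; +<+)
import Data.Integer.Properties as ℤ
open import Data.Product using (_×_; _,_; proj₁; proj₂; map₁; map₂; uncurry)
open import Data.Product.Properties using (≡-dec)
open import Data.Sum using (inj₁; inj₂)
open import Data.List using (List; []; _∷_; _++_; [_]; map; foldr)
open import Data.List.Relation.Unary.All using (All; []; _∷_; all?)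
open import Relation.Binary.PropositionalEquality hiding ([_])
open import Relation.Binary.Definitions using (DecidableEquality)
open import Relation.Nullary using (Dec; yes; no)
open import Relation.Nullary.Decidable using (from-yes)
open import Data.Integer.Tactic.RingSolver using (solve-∀)
open import Algebra.Properties.AbelianGroup ℤ.+-0-abelianGroup using (∙-cancelʳ)
open import Algebra.Properties.CommutativeSemigroup ℤ.+-commutativeSemigroup
  using (xy∙z≈yx∙z; xy∙z≈xz∙y; xy∙z≈zy∙x)

-- Coefficient arrays and multiplication by Q

Grid : Set
Grid = ℤ → ℤ → ℤ → ℤ

infix 4 _≐_
_≐_ : Grid → Grid → Set
F ≐ G = ∀ i j k → F i j k ≡ G i j k

record Supported (F : Grid) : Set where
  field
    x<0 : ∀ m j k → F -[1+ m ] j k ≡ 0ℤ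
    y<0 : ∀ i m k → F i -[1+ m ] k ≡ 0ℤ
    z<0 : ∀ i j m → F i j -[1+ m ] ≡ 0ℤ
open Supported

extend : (ℕ → ℕ → ℕ → ℤ) → Grid
extend f (+ a) (+ b) (+ c) = f a b c
extend f _     _     _     = 0ℤ

extend-supported : ∀ f → Supported (extend f)
extend-supported f = record
  { x<0 = λ _ _ _ → refl
  ; y<0 = λ { (+ _) _ _ → refl ; -[1+ _ ] _ _ → refl }
  ; z<0 = λ { (+ _) (+ _) _ → refl ; (+ _) -[1+ _ ] _ → refl ; -[1+ _ ] _ _ → refl }
  }

supported-≐ : ∀ {F G} → Supported F → Supported G →
              (∀ a b c → F (+ a) (+ b) (+ c) ≡ G (+ a) (+ b) (+ c)) → F ≐ G
supported-≐ sF sG eq (+ a)    (+ b)    (+ c)    = eq a b c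
supported-≐ sF sG eq -[1+ m ] j        k        = trans (x<0 sF m j k) (sym (x<0 sG m j k))
supported-≐ sF sG eq (+ a)    -[1+ m ] k        = trans (y<0 sF _ m k) (sym (y<0 sG _ m k))
supported-≐ sF sG eq (+ a)    (+ b)    -[1+ m ] = trans (z<0 sF _ _ m) (sym (z<0 sG _ _ m))

Q·_ : Grid → Grid
(Q· F) i j k =
  F i j k - + 2 * (F (pred i) j k + F i (pred j) k + F i j (pred k))
          + + 3 * (F (pred i) (pred j) k + F i (pred j) (pred k) + F (pred i) j (pred k))

private
  stencil-zero : ∀ {f f₁ f₂ f₃ f₄ f₅ f₆ : ℤ} →
    f ≡ 0ℤ → f₁ ≡ 0ℤ → f₂ ≡ 0ℤ → f₃ ≡ 0ℤ → f₄ ≡ 0ℤ → f₅ ≡ 0ℤ → f₆ ≡ 0ℤ →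
    f - + 2 * (f₁ + f₂ + f₃) + + 3 * (f₄ + f₅ + f₆) ≡ 0ℤ
  stencil-zero refl refl refl refl refl refl refl = refl

  stencil-cancel : ∀ {f g f₁ f₂ f₃ f₄ f₅ f₆ g₁ g₂ g₃ g₄ g₅ g₆ : ℤ} →
    f - + 2 * (f₁ + f₂ + f₃) + + 3 * (f₄ + f₅ + f₆) ≡ g - + 2 * (g₁ + g₂ + g₃) + + 3 * (g₄ + g₅ + g₆) →
    f₁ ≡ g₁ → f₂ ≡ g₂ → f₃ ≡ g₃ → f₄ ≡ g₄ → f₅ ≡ g₅ → f₆ ≡ g₆ → f ≡ g
  stencil-cancel eq refl refl refl refl refl refl = ∙-cancelʳ _ _ _ (∙-cancelʳ _ _ _ eq)

Q·-supported : ∀ {F} → Supported F → Supported (Q· F)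
Q·-supported sF = record
  { x<0 = λ m j k → stencil-zero (x<0 sF m j k) (x<0 sF (suc m) j k) (x<0 sF m _ k) (x<0 sF m j _)
                                 (x<0 sF (suc m) _ k) (x<0 sF m _ _) (x<0 sF (suc m) j _)
  ; y<0 = λ i m k → stencil-zero (y<0 sF i m k) (y<0 sF _ m k) (y<0 sF i (suc m) k) (y<0 sF i m _)
                                 (y<0 sF _ (suc m) k) (y<0 sF i (suc m) _) (y<0 sF _ m _)
  ; z<0 = λ i j m → stencil-zero (z<0 sF i j m) (z<0 sF _ j m) (z<0 sF i _ m) (z<0 sF i j (suc m))
                                 (z<0 sF _ _ m) (z<0 sF i _ (suc m)) (z<0 sF _ j (suc m))
  }

ℤ-induction : {P : ℤ → Set} → (∀ m → P -[1+ m ]) → (∀ n → P (pred (+ n)) → P (+ n)) → ∀ i → P i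
ℤ-induction     neg step -[1+ m ]  = neg m
ℤ-induction     neg step (+ zero)  = step zero (neg zero)
ℤ-induction {P} neg step (+ suc n) = step (suc n) (ℤ-induction {P} neg step (+ n))

-- The coefficient at (a,b,c) is determined by the Q-recurrence there and by the coefficients
-- at lexicographically smaller indices.
Q·-injective : ∀ {F G} → Supported F → Supported G →
               (∀ a b c → (Q· F) (+ a) (+ b) (+ c) ≡ (Q· G) (+ a) (+ b) (+ c)) → F ≐ G
Q·-injective sF sG eq =
  ℤ-induction (λ m j k → trans (x<0 sF m j k) (sym (x<0 sG m j k))) λ a below →
  ℤ-induction (λ m k → trans (y<0 sF _ m k) (sym (y<0 sG _ m k))) λ b left →
  ℤ-induction (λ m → trans (z<0 sF _ _ m) (sym (z<0 sG _ _ m))) λ c back →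
  stencil-cancel (eq a b c) (below _ _) (left _) back (below _ _) (left _) (below _ _)

Q⁻¹ : (ℕ → ℕ → ℕ → ℤ) → ℕ → ℕ → ℕ → ℤ
Q⁻¹ g zero    zero    zero    = g zero zero zero
Q⁻¹ g (suc a) zero    zero    = g (suc a) zero zero + + 2 * Q⁻¹ g a zero zero
Q⁻¹ g zero    (suc b) zero    = g zero (suc b) zero + + 2 * Q⁻¹ g zero b zero
Q⁻¹ g zero    zero    (suc c) = g zero zero (suc c) + + 2 * Q⁻¹ g zero zero c
Q⁻¹ g (suc a) (suc b) zero    = g (suc a) (suc b) zero +
  (+ 2 * (Q⁻¹ g a (suc b) zero + Q⁻¹ g (suc a) b zero) - + 3 * Q⁻¹ g a b zero)
Q⁻¹ g (suc a) zero    (suc c) = g (suc a) zero (suc c) +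
  (+ 2 * (Q⁻¹ g a zero (suc c) + Q⁻¹ g (suc a) zero c) - + 3 * Q⁻¹ g a zero c)
Q⁻¹ g zero    (suc b) (suc c) = g zero (suc b) (suc c) +
  (+ 2 * (Q⁻¹ g zero b (suc c) + Q⁻¹ g zero (suc b) c) - + 3 * Q⁻¹ g zero b c)
Q⁻¹ g (suc a) (suc b) (suc c) = g (suc a) (suc b) (suc c) +
  (+ 2 * (Q⁻¹ g a (suc b) (suc c) + Q⁻¹ g (suc a) b (suc c) + Q⁻¹ g (suc a) (suc b) c)
   - + 3 * (Q⁻¹ g a b (suc c) + Q⁻¹ g (suc a) b c + Q⁻¹ g a (suc b) c))

-- Read against Q·, each clause of Q⁻¹ is the Q-recurrence with the neighbours outside ℕ³ set to 0.
private
  step-x : ∀ t u → t + + 2 * u - + 2 * (u + 0ℤ + 0ℤ) + + 3 * (0ℤ + 0ℤ + 0ℤ) ≡ t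
  step-x = solve-∀
  step-y : ∀ t u → t + + 2 * u - + 2 * (0ℤ + u + 0ℤ) + + 3 * (0ℤ + 0ℤ + 0ℤ) ≡ t
  step-y = solve-∀
  step-z : ∀ t u → t + + 2 * u - + 2 * (0ℤ + 0ℤ + u) + + 3 * (0ℤ + 0ℤ + 0ℤ) ≡ t
  step-z = solve-∀
  step-xy : ∀ t u v w →
    t + (+ 2 * (u + v) - + 3 * w) - + 2 * (u + v + 0ℤ) + + 3 * (w + 0ℤ + 0ℤ) ≡ t
  step-xy = solve-∀
  step-xz : ∀ t u v w →
    t + (+ 2 * (u + v) - + 3 * w) - + 2 * (u + 0ℤ + v) + + 3 * (0ℤ + 0ℤ + w) ≡ t
  step-xz = solve-∀
  step-yz : ∀ t u v w →
    t + (+ 2 * (u + v) - + 3 * w) - + 2 * (0ℤ + u + v) + + 3 * (0ℤ + w + 0ℤ) ≡ t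
  step-yz = solve-∀
  step-xyz : ∀ t n m → t + (+ 2 * n - + 3 * m) - + 2 * n + + 3 * m ≡ t
  step-xyz = solve-∀

Q·-Q⁻¹ : ∀ g → Q· extend (Q⁻¹ g) ≐ extend g
Q·-Q⁻¹ g = supported-≐ (Q·-supported (extend-supported F)) (extend-supported g) octant
  where
  F = Q⁻¹ g
  octant : ∀ a b c → (Q· extend F) (+ a) (+ b) (+ c) ≡ g a b c
  octant zero    zero    zero    = trans (ℤ.+-identityʳ _) (ℤ.+-identityʳ _)
  octant (suc a) zero    zero    = step-x _ (F a 0 0)
  octant zero    (suc b) zero    = step-y _ (F 0 b 0)
  octant zero    zero    (suc c) = step-z _ (F 0 0 c)
  octant (suc a) (suc b) zero    = step-xy _ (F a (suc b) 0) (F (suc a) b 0) (F a b 0)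
  octant (suc a) zero    (suc c) = step-xz _ (F a 0 (suc c)) (F (suc a) 0 c) (F a 0 c)
  octant zero    (suc b) (suc c) = step-yz _ (F 0 b (suc c)) (F 0 (suc b) c) (F 0 b c)
  octant (suc a) (suc b) (suc c) = step-xyz _
    (F a (suc b) (suc c) + F (suc a) b (suc c) + F (suc a) (suc b) c)
    (F a b (suc c) + F (suc a) b c + F a (suc b) c)

unit : ℕ → ℕ → ℕ → ℤ
unit zero zero zero = + 1
unit _    _    _    = 0ℤ

private
  source-free₁ : ∀ {u u′} → u ≡ u′ → + 2 * u ≡ 0ℤ + + 2 * u′
  source-free₁ refl = sym (ℤ.+-identityˡ _)
  source-free₂ : ∀ {u v w u′ v′ w′} → u ≡ u′ → v ≡ v′ → w ≡ w′ →
    + 2 * (u + v) - + 3 * w ≡ 0ℤ + (+ 2 * (u′ + v′) - + 3 * w′)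
  source-free₂ refl refl refl = sym (ℤ.+-identityˡ _)
  source-free₃ : ∀ {u v w p q r u′ v′ w′ p′ q′ r′} →
    u ≡ u′ → v ≡ v′ → w ≡ w′ → p ≡ p′ → q ≡ q′ → r ≡ r′ →
    + 2 * (u + v + w) - + 3 * (p + q + r) ≡ 0ℤ + (+ 2 * (u′ + v′ + w′) - + 3 * (p′ + q′ + r′))
  source-free₃ refl refl refl refl refl refl = sym (ℤ.+-identityˡ _)

coeff≡Q⁻¹unit : ∀ a b c → coeff a b c ≡ Q⁻¹ unit a b c
coeff≡Q⁻¹unit zero    zero    zero    = refl
coeff≡Q⁻¹unit (suc a) zero    zero    = source-free₁ (coeff≡Q⁻¹unit a 0 0)
coeff≡Q⁻¹unit zero    (suc b) zero    = source-free₁ (coeff≡Q⁻¹unit 0 b 0)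
coeff≡Q⁻¹unit zero    zero    (suc c) = source-free₁ (coeff≡Q⁻¹unit 0 0 c)
coeff≡Q⁻¹unit (suc a) (suc b) zero    = source-free₂
  (coeff≡Q⁻¹unit a (suc b) 0) (coeff≡Q⁻¹unit (suc a) b 0) (coeff≡Q⁻¹unit a b 0)
coeff≡Q⁻¹unit (suc a) zero    (suc c) = source-free₂
  (coeff≡Q⁻¹unit a 0 (suc c)) (coeff≡Q⁻¹unit (suc a) 0 c) (coeff≡Q⁻¹unit a 0 c)
coeff≡Q⁻¹unit zero    (suc b) (suc c) = source-free₂
  (coeff≡Q⁻¹unit 0 b (suc c)) (coeff≡Q⁻¹unit 0 (suc b) c) (coeff≡Q⁻¹unit 0 b c)
coeff≡Q⁻¹unit (suc a) (suc b) (suc c) = source-free₃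
  (coeff≡Q⁻¹unit a (suc b) (suc c)) (coeff≡Q⁻¹unit (suc a) b (suc c)) (coeff≡Q⁻¹unit (suc a) (suc b) c)
  (coeff≡Q⁻¹unit a b (suc c)) (coeff≡Q⁻¹unit (suc a) b c) (coeff≡Q⁻¹unit a (suc b) c)

Q·-cong : ∀ {F G} → F ≐ G → Q· F ≐ Q· G
Q·-cong eq i j k
  rewrite eq i j k | eq (pred i) j k | eq i (pred j) k | eq i j (pred k)
        | eq (pred i) (pred j) k | eq i (pred j) (pred k) | eq (pred i) j (pred k) = refl

-- Coefficient arrays of 1, of S(2x,2y,2z) and of its square.
δ S S² : Grid
δ  = extend unit
S  = extend coeff
S² = extend (Q⁻¹ coeff)

δ-supported : Supported δ
δ-supported = extend-supported unit

S-supported : Supported S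
S-supported = extend-supported coeff

S²-supported : Supported S²
S²-supported = extend-supported (Q⁻¹ coeff)

Q·S≐δ : Q· S ≐ δ
Q·S≐δ i j k = trans (Q·-cong S≐ i j k) (Q·-Q⁻¹ unit i j k)
  where
  S≐ : S ≐ extend (Q⁻¹ unit)
  S≐ = supported-≐ S-supported (extend-supported (Q⁻¹ unit)) coeff≡Q⁻¹unit

Q·S²≐S : Q· S² ≐ S
Q·S²≐S = Q·-Q⁻¹ coeff

-- Symmetry

swapˣʸ swapʸᶻ : Grid → Grid
swapˣʸ F i j k = F j i k
swapʸᶻ F i j k = F i k j

Symmetric : Grid → Set
Symmetric F = swapˣʸ F ≐ F × swapʸᶻ F ≐ F

swapˣʸ-supported : ∀ {F} → Supported F → Supported (swapˣʸ F)
swapˣʸ-supported sF = record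
  { x<0 = λ m j k → y<0 sF j m k ; y<0 = λ i m k → x<0 sF m i k ; z<0 = λ i j m → z<0 sF j i m }

swapʸᶻ-supported : ∀ {F} → Supported F → Supported (swapʸᶻ F)
swapʸᶻ-supported sF = record
  { x<0 = λ m j k → x<0 sF m k j ; y<0 = λ i m k → z<0 sF i k m ; z<0 = λ i j m → y<0 sF i m j }

Q·-swapˣʸ : ∀ F → (Q· swapˣʸ F) ≐ swapˣʸ (Q· F)
Q·-swapˣʸ F i j k = cong₂ (λ n m → F j i k - + 2 * n + + 3 * m)
  (xy∙z≈yx∙z (F j (pred i) k) (F (pred j) i k) (F j i (pred k)))
  (xy∙z≈xz∙y (F (pred j) (pred i) k) (F (pred j) i (pred k)) (F j (pred i) (pred k)))

Q·-swapʸᶻ : ∀ F → (Q· swapʸᶻ F) ≐ swapʸᶻ (Q· F)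
Q·-swapʸᶻ F i j k = cong₂ (λ n m → F i k j - + 2 * n + + 3 * m)
  (xy∙z≈xz∙y (F (pred i) k j) (F i k (pred j)) (F i (pred k) j))
  (xy∙z≈zy∙x (F (pred i) k (pred j)) (F i (pred k) (pred j)) (F (pred i) (pred k) j))

symmetric-≐ : ∀ {F G} → F ≐ G → Symmetric G → Symmetric F
symmetric-≐ eq (σ , τ) =
  (λ i j k → trans (eq j i k) (trans (σ i j k) (sym (eq i j k)))) ,
  (λ i j k → trans (eq i k j) (trans (τ i j k) (sym (eq i j k))))

symmetric-Q· : ∀ {F} → Supported F → Symmetric (Q· F) → Symmetric F
symmetric-Q· {F} sF (σ , τ) =
  Q·-injective (swapˣʸ-supported sF) sF (λ a b c → trans (Q·-swapˣʸ F _ _ _) (σ _ _ _)) ,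
  Q·-injective (swapʸᶻ-supported sF) sF (λ a b c → trans (Q·-swapʸᶻ F _ _ _) (τ _ _ _))

δ-symmetric : Symmetric δ
δ-symmetric =
  supported-≐ (swapˣʸ-supported δ-supported) δ-supported unit-swapˣʸ ,
  supported-≐ (swapʸᶻ-supported δ-supported) δ-supported unit-swapʸᶻ
  where
  unit-swapˣʸ : ∀ a b c → unit b a c ≡ unit a b c
  unit-swapˣʸ zero    zero    c = refl
  unit-swapˣʸ zero    (suc b) c = refl
  unit-swapˣʸ (suc a) zero    c = refl
  unit-swapˣʸ (suc a) (suc b) c = refl
  unit-swapʸᶻ : ∀ a b c → unit a c b ≡ unit a b c
  unit-swapʸᶻ (suc a) b       c       = refl
  unit-swapʸᶻ zero    zero    zero    = refl
  unit-swapʸᶻ zero    zero    (suc c) = refl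
  unit-swapʸᶻ zero    (suc b) zero    = refl
  unit-swapʸᶻ zero    (suc b) (suc c) = refl

S-symmetric : Symmetric S
S-symmetric = symmetric-Q· S-supported (symmetric-≐ Q·S≐δ δ-symmetric)

S²-symmetric : Symmetric S²
S²-symmetric = symmetric-Q· S²-supported (symmetric-≐ Q·S²≐S S-symmetric)

-- Euler's identity

x∂ₓ_ -xQₓ·_ : Grid → Grid
(x∂ₓ F) i j k = i * F i j k
(-xQₓ· F) i j k = + 2 * F (pred i) j k - + 3 * (F (pred i) (pred j) k + F (pred i) j (pred k))

x∂ₓ-supported : ∀ {F} → Supported F → Supported (x∂ₓ F)
x∂ₓ-supported sF = record
  { x<0 = λ m j k → times-zero -[1+ m ] (x<0 sF m j k)
  ; y<0 = λ i m k → times-zero i (y<0 sF i m k)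
  ; z<0 = λ i j m → times-zero i (z<0 sF i j m)
  }
  where
  times-zero : ∀ i {f} → f ≡ 0ℤ → i * f ≡ 0ℤ
  times-zero i refl = ℤ.*-zeroʳ i

-xQₓ·-supported : ∀ {F} → Supported F → Supported (-xQₓ· F)
-xQₓ·-supported sF = record
  { x<0 = λ m j k → combination-zero (x<0 sF _ j k) (x<0 sF _ _ k) (x<0 sF _ j _)
  ; y<0 = λ i m k → combination-zero (y<0 sF _ m k) (y<0 sF _ _ k) (y<0 sF _ m _)
  ; z<0 = λ i j m → combination-zero (z<0 sF _ j m) (z<0 sF _ _ m) (z<0 sF _ j _)
  }
  where
  combination-zero : ∀ {u v w} → u ≡ 0ℤ → v ≡ 0ℤ → w ≡ 0ℤ → + 2 * u - + 3 * (v + w) ≡ 0ℤ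
  combination-zero refl refl refl = refl

-xQₓ·-cong : ∀ {F G} → F ≐ G → -xQₓ· F ≐ -xQₓ· G
-xQₓ·-cong eq i j k =
  cong₂ (λ u v → + 2 * u - + 3 * v) (eq _ _ _) (cong₂ _+_ (eq _ _ _) (eq _ _ _))

Q·-x∂ₓ : ∀ F i j k → (Q· x∂ₓ F) i j k ≡ i * (Q· F) i j k + (-xQₓ· F) i j k
Q·-x∂ₓ F i j k = leibniz i (F i j k) (F (pred i) j k) (F i (pred j) k) (F i j (pred k))
  (F (pred i) (pred j) k) (F i (pred j) (pred k)) (F (pred i) j (pred k))
  where
  leibniz : ∀ i f f₁ f₂ f₃ f₄ f₅ f₆ →
    let q = λ g g₁ g₂ g₃ g₄ g₅ g₆ → g - + 2 * (g₁ + g₂ + g₃) + + 3 * (g₄ + g₅ + g₆) in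
    q (i * f) ((-1ℤ + i) * f₁) (i * f₂) (i * f₃) ((-1ℤ + i) * f₄) (i * f₅) ((-1ℤ + i) * f₆)
      ≡ i * q f f₁ f₂ f₃ f₄ f₅ f₆ + (+ 2 * f₁ - + 3 * (f₄ + f₆))
  leibniz = solve-∀

Q·--xQₓ· : ∀ F → (Q· -xQₓ· F) ≐ -xQₓ· (Q· F)
Q·--xQₓ· F i j k = commute
  (F (pred i) j k) (F (pred (pred i)) j k) (F (pred i) (pred j) k) (F (pred i) j (pred k))
  (F (pred (pred i)) (pred j) k) (F (pred (pred i)) j (pred k)) (F (pred i) (pred (pred j)) k)
  (F (pred i) (pred j) (pred k)) (F (pred i) j (pred (pred k))) (F (pred (pred i)) (pred (pred j)) k)
  (F (pred (pred i)) (pred j) (pred k)) (F (pred i) (pred (pred j)) (pred k))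
  (F (pred i) (pred j) (pred (pred k))) (F (pred (pred i)) j (pred (pred k)))
  where
  commute : ∀ f₁₀₀ f₂₀₀ f₁₁₀ f₁₀₁ f₂₁₀ f₂₀₁ f₁₂₀ f₁₁₁ f₁₀₂ f₂₂₀ f₂₁₁ f₁₂₁ f₁₁₂ f₂₀₂ →
    let q = λ g g₁ g₂ g₃ g₄ g₅ g₆ → g - + 2 * (g₁ + g₂ + g₃) + + 3 * (g₄ + g₅ + g₆)
        p = λ g₁ g₄ g₆ → + 2 * g₁ - + 3 * (g₄ + g₆) in
    q (p f₁₀₀ f₁₁₀ f₁₀₁) (p f₂₀₀ f₂₁₀ f₂₀₁) (p f₁₁₀ f₁₂₀ f₁₁₁) (p f₁₀₁ f₁₁₁ f₁₀₂)
      (p f₂₁₀ f₂₂₀ f₂₁₁) (p f₁₁₁ f₁₂₁ f₁₁₂) (p f₂₀₁ f₂₁₁ f₂₀₂)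
      ≡ p (q f₁₀₀ f₂₀₀ f₁₁₀ f₁₀₁ f₂₁₀ f₁₁₁ f₂₀₁) (q f₁₁₀ f₂₁₀ f₁₂₀ f₁₁₁ f₂₂₀ f₁₂₁ f₂₁₁)
          (q f₁₀₁ f₂₀₁ f₁₁₁ f₁₀₂ f₂₁₁ f₁₁₂ f₂₀₂)
  commute = solve-∀

-- Both sides are supported and have the same product with Q, namely -x (∂Q/∂x) S.
x∂ₓS≐-xQₓ·S² : x∂ₓ S ≐ -xQₓ· S²
x∂ₓS≐-xQₓ·S² = Q·-injective (x∂ₓ-supported S-supported) (-xQₓ·-supported S²-supported) λ a b c →
  let x = + a; y = + b; z = + c in begin
  (Q· x∂ₓ S) x y z                  ≡⟨ Q·-x∂ₓ S x y z ⟩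
  x * (Q· S) x y z + (-xQₓ· S) x y z ≡⟨ cong (λ e → x * e + (-xQₓ· S) x y z) (Q·S≐δ x y z) ⟩
  x * δ x y z + (-xQₓ· S) x y z     ≡⟨ cong (λ e → e + (-xQₓ· S) x y z) (x∂ₓ-unit a b c) ⟩
  0ℤ + (-xQₓ· S) x y z              ≡⟨ ℤ.+-identityˡ _ ⟩
  (-xQₓ· S) x y z                   ≡⟨ -xQₓ·-cong (λ i j k → sym (Q·S²≐S i j k)) x y z ⟩
  (-xQₓ· Q· S²) x y z               ≡⟨ sym (Q·--xQₓ· S² x y z) ⟩
  (Q· -xQₓ· S²) x y z               ∎
  where
  open ≡-Reasoning
  x∂ₓ-unit : ∀ a b c → + a * unit a b c ≡ 0ℤ
  x∂ₓ-unit zero    b c = refl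
  x∂ₓ-unit (suc a) b c = ℤ.*-zeroʳ (+ suc a)

-- Polynomial linear forms

-- Integer polynomials, constant coefficient first.
Poly : Set
Poly = List ℤ

⟦_⟧ₚ : Poly → ℤ → ℤ
⟦ []     ⟧ₚ x = 0ℤ
⟦ c ∷ cs ⟧ₚ x = c + x * ⟦ cs ⟧ₚ x

infixl 6 _+ₚ_
infixl 7 _*ₚ_

_+ₚ_ : Poly → Poly → Poly
[]       +ₚ ds       = ds
(c ∷ cs) +ₚ []       = c ∷ cs
(c ∷ cs) +ₚ (d ∷ ds) = c + d ∷ cs +ₚ ds

_*ₚ_ : Poly → Poly → Poly
[]       *ₚ ds = []
(c ∷ cs) *ₚ ds = map (c *_) ds +ₚ (0ℤ ∷ cs *ₚ ds)

⟦+ₚ⟧ : ∀ cs ds x → ⟦ cs +ₚ ds ⟧ₚ x ≡ ⟦ cs ⟧ₚ x + ⟦ ds ⟧ₚ x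
⟦+ₚ⟧ []       ds       x = sym (ℤ.+-identityˡ _)
⟦+ₚ⟧ (c ∷ cs) []       x = sym (ℤ.+-identityʳ _)
⟦+ₚ⟧ (c ∷ cs) (d ∷ ds) x = begin
  c + d + x * ⟦ cs +ₚ ds ⟧ₚ x              ≡⟨ cong (λ e → c + d + x * e) (⟦+ₚ⟧ cs ds x) ⟩
  c + d + x * (⟦ cs ⟧ₚ x + ⟦ ds ⟧ₚ x)      ≡⟨ horner c d x (⟦ cs ⟧ₚ x) (⟦ ds ⟧ₚ x) ⟩
  c + x * ⟦ cs ⟧ₚ x + (d + x * ⟦ ds ⟧ₚ x) ∎
  where
  open ≡-Reasoning
  horner : ∀ c d x u v → c + d + x * (u + v) ≡ c + x * u + (d + x * v)
  horner = solve-∀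

⟦scale⟧ : ∀ c ds x → ⟦ map (c *_) ds ⟧ₚ x ≡ c * ⟦ ds ⟧ₚ x
⟦scale⟧ c []       x = sym (ℤ.*-zeroʳ c)
⟦scale⟧ c (d ∷ ds) x = begin
  c * d + x * ⟦ map (c *_) ds ⟧ₚ x ≡⟨ cong (λ e → c * d + x * e) (⟦scale⟧ c ds x) ⟩
  c * d + x * (c * ⟦ ds ⟧ₚ x)      ≡⟨ horner c d x (⟦ ds ⟧ₚ x) ⟩
  c * (d + x * ⟦ ds ⟧ₚ x)          ∎
  where
  open ≡-Reasoning
  horner : ∀ c d x v → c * d + x * (c * v) ≡ c * (d + x * v)
  horner = solve-∀

⟦*ₚ⟧ : ∀ cs ds x → ⟦ cs *ₚ ds ⟧ₚ x ≡ ⟦ cs ⟧ₚ x * ⟦ ds ⟧ₚ x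
⟦*ₚ⟧ []       ds x = refl
⟦*ₚ⟧ (c ∷ cs) ds x = begin
  ⟦ map (c *_) ds +ₚ (0ℤ ∷ cs *ₚ ds) ⟧ₚ x              ≡⟨ ⟦+ₚ⟧ (map (c *_) ds) _ x ⟩
  ⟦ map (c *_) ds ⟧ₚ x + (0ℤ + x * ⟦ cs *ₚ ds ⟧ₚ x)   ≡⟨ cong₂ (λ u v → u + (0ℤ + x * v))
                                                              (⟦scale⟧ c ds x) (⟦*ₚ⟧ cs ds x) ⟩
  c * ⟦ ds ⟧ₚ x + (0ℤ + x * (⟦ cs ⟧ₚ x * ⟦ ds ⟧ₚ x))  ≡⟨ horner c x (⟦ cs ⟧ₚ x) (⟦ ds ⟧ₚ x) ⟩
  (c + x * ⟦ cs ⟧ₚ x) * ⟦ ds ⟧ₚ x                     ∎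
  where
  open ≡-Reasoning
  horner : ∀ c x u v → c * v + (0ℤ + x * (u * v)) ≡ (c + x * u) * v
  horner = solve-∀

⟦zero⟧ₚ : ∀ {cs} x → All (_≡ 0ℤ) cs → ⟦ cs ⟧ₚ x ≡ 0ℤ
⟦zero⟧ₚ x []         = refl
⟦zero⟧ₚ x (refl ∷ z) = trans (ℤ.+-identityˡ _) (trans (cong (x *_) (⟦zero⟧ₚ x z)) (ℤ.*-zeroʳ x))

-- Linear forms in unknowns k : K with coefficients in ℤ[x]; Vanishes F is decided by
-- collecting like terms.
module LinearForms {K : Set} (_≟_ : DecidableEquality K) where

  Form : Set
  Form = List (Poly × K)

  ⟦_⟧ : Form → ℤ → (K → ℤ) → ℤ
  ⟦ []           ⟧ x ρ = 0ℤ
  ⟦ (cs , k) ∷ F ⟧ x ρ = ⟦ cs ⟧ₚ x * ρ k + ⟦ F ⟧ x ρ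

  ⟦++⟧ : ∀ F G x ρ → ⟦ F ++ G ⟧ x ρ ≡ ⟦ F ⟧ x ρ + ⟦ G ⟧ x ρ
  ⟦++⟧ []             G x ρ = sym (ℤ.+-identityˡ _)
  ⟦++⟧ ((cs , k) ∷ F) G x ρ =
    trans (cong (λ e → ⟦ cs ⟧ₚ x * ρ k + e) (⟦++⟧ F G x ρ))
          (sym (ℤ.+-assoc (⟦ cs ⟧ₚ x * ρ k) (⟦ F ⟧ x ρ) (⟦ G ⟧ x ρ)))

  infixr 7 _*ᶠ_
  _*ᶠ_ : Poly → Form → Form
  cs *ᶠ F = map (map₁ (cs *ₚ_)) F

  ⟦*ᶠ⟧ : ∀ cs F x ρ → ⟦ cs *ᶠ F ⟧ x ρ ≡ ⟦ cs ⟧ₚ x * ⟦ F ⟧ x ρ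
  ⟦*ᶠ⟧ cs []             x ρ = sym (ℤ.*-zeroʳ (⟦ cs ⟧ₚ x))
  ⟦*ᶠ⟧ cs ((ds , k) ∷ F) x ρ = begin
    ⟦ cs *ₚ ds ⟧ₚ x * ρ k + ⟦ cs *ᶠ F ⟧ x ρ
      ≡⟨ cong₂ (λ u v → u * ρ k + v) (⟦*ₚ⟧ cs ds x) (⟦*ᶠ⟧ cs F x ρ) ⟩
    ⟦ cs ⟧ₚ x * ⟦ ds ⟧ₚ x * ρ k + ⟦ cs ⟧ₚ x * ⟦ F ⟧ x ρ
      ≡⟨ distrib (⟦ cs ⟧ₚ x) (⟦ ds ⟧ₚ x) (ρ k) (⟦ F ⟧ x ρ) ⟩
    ⟦ cs ⟧ₚ x * (⟦ ds ⟧ₚ x * ρ k + ⟦ F ⟧ x ρ)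
      ∎
    where
    open ≡-Reasoning
    distrib : ∀ u v r w → u * v * r + u * w ≡ u * (v * r + w)
    distrib = solve-∀

  rename : (K → K) → Form → Form
  rename f = map (map₂ f)

  ⟦rename⟧ : ∀ f F x ρ → (∀ k → ρ (f k) ≡ ρ k) → ⟦ rename f F ⟧ x ρ ≡ ⟦ F ⟧ x ρ
  ⟦rename⟧ f []             x ρ inv = refl
  ⟦rename⟧ f ((cs , k) ∷ F) x ρ inv =
    cong₂ (λ u v → ⟦ cs ⟧ₚ x * u + v) (inv k) (⟦rename⟧ f F x ρ inv)

  insert : Poly → K → Form → Form
  insert cs k [] = [ cs , k ]
  insert cs k ((ds , k′) ∷ F) with k ≟ k′
  ... | yes _ = (cs +ₚ ds , k′) ∷ F
  ... | no  _ = (ds , k′) ∷ insert cs k F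

  collect : Form → Form
  collect = foldr (uncurry insert) []

  ⟦insert⟧ : ∀ cs k F x ρ → ⟦ insert cs k F ⟧ x ρ ≡ ⟦ cs ⟧ₚ x * ρ k + ⟦ F ⟧ x ρ
  ⟦insert⟧ cs k [] x ρ = refl
  ⟦insert⟧ cs k ((ds , k′) ∷ F) x ρ with k ≟ k′
  ... | yes refl = trans (cong (λ u → u * ρ k + ⟦ F ⟧ x ρ) (⟦+ₚ⟧ cs ds x))
                         (merge (⟦ cs ⟧ₚ x) (⟦ ds ⟧ₚ x) (ρ k) (⟦ F ⟧ x ρ))
    where
    merge : ∀ u v r w → (u + v) * r + w ≡ u * r + (v * r + w)
    merge = solve-∀
  ... | no  _    = trans (cong (λ e → ⟦ ds ⟧ₚ x * ρ k′ + e) (⟦insert⟧ cs k F x ρ))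
                         (swap (⟦ cs ⟧ₚ x * ρ k) (⟦ ds ⟧ₚ x * ρ k′) (⟦ F ⟧ x ρ))
    where
    swap : ∀ u v w → v + (u + w) ≡ u + (v + w)
    swap = solve-∀

  ⟦collect⟧ : ∀ F x ρ → ⟦ collect F ⟧ x ρ ≡ ⟦ F ⟧ x ρ
  ⟦collect⟧ []             x ρ = refl
  ⟦collect⟧ ((cs , k) ∷ F) x ρ =
    trans (⟦insert⟧ cs k (collect F) x ρ) (cong (λ e → ⟦ cs ⟧ₚ x * ρ k + e) (⟦collect⟧ F x ρ))

  Vanishes : Form → Set
  Vanishes F = All (λ term → All (_≡ 0ℤ) (proj₁ term)) (collect F)

  vanishes? : ∀ F → Dec (Vanishes F)
  vanishes? F = all? (λ term → all? (ℤ._≟ 0ℤ) (proj₁ term)) (collect F)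

  ⟦vanishing⟧ : ∀ F x ρ → Vanishes F → ⟦ F ⟧ x ρ ≡ 0ℤ
  ⟦vanishing⟧ F x ρ v = trans (sym (⟦collect⟧ F x ρ)) (go v)
    where
    go : ∀ {G} → All (λ term → All (_≡ 0ℤ) (proj₁ term)) G → ⟦ G ⟧ x ρ ≡ 0ℤ
    go []      = refl
    go (z ∷ v) = cong₂ _+_ (cong (_* _) (⟦zero⟧ₚ x z)) (go v)

  combination : {R : Set} → (R → Form) → List (Poly × R) → Form
  combination form []             = []
  combination form ((cs , r) ∷ C) = cs *ᶠ form r ++ combination form C

  ⟦combination⟧ : ∀ {R} (form : R → Form) C x ρ → (∀ r → ⟦ form r ⟧ x ρ ≡ 0ℤ) →
                  ⟦ combination form C ⟧ x ρ ≡ 0ℤ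
  ⟦combination⟧ form []             x ρ valid = refl
  ⟦combination⟧ form ((cs , r) ∷ C) x ρ valid = begin
    ⟦ cs *ᶠ form r ++ combination form C ⟧ x ρ
      ≡⟨ ⟦++⟧ (cs *ᶠ form r) (combination form C) x ρ ⟩
    ⟦ cs *ᶠ form r ⟧ x ρ + ⟦ combination form C ⟧ x ρ
      ≡⟨ cong₂ _+_ (trans (⟦*ᶠ⟧ cs (form r) x ρ) (cong (⟦ cs ⟧ₚ x *_) (valid r)))
                   (⟦combination⟧ form C x ρ valid) ⟩
    ⟦ cs ⟧ₚ x * 0ℤ + 0ℤ
      ≡⟨ trans (ℤ.+-identityʳ _) (ℤ.*-zeroʳ (⟦ cs ⟧ₚ x)) ⟩
    0ℤ ∎
    where open ≡-Reasoning

  -- T vanishes wherever the forms do, once T + Σ cs · form r collects to zero;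
  -- the renaming f may merge unknowns that ρ does not distinguish.
  certified : ∀ {R} (form : R → Form) T C f x ρ →
              (∀ k → ρ (f k) ≡ ρ k) → (∀ r → ⟦ form r ⟧ x ρ ≡ 0ℤ) →
              Vanishes (rename f (T ++ combination form C)) → ⟦ T ⟧ x ρ ≡ 0ℤ
  certified form T C f x ρ inv valid vanishes = begin
    ⟦ T ⟧ x ρ                                 ≡⟨ sym (ℤ.+-identityʳ _) ⟩
    ⟦ T ⟧ x ρ + 0ℤ                            ≡⟨ cong (λ e → ⟦ T ⟧ x ρ + e)
                                                     (sym (⟦combination⟧ form C x ρ valid)) ⟩
    ⟦ T ⟧ x ρ + ⟦ combination form C ⟧ x ρ    ≡⟨ sym (⟦++⟧ T (combination form C) x ρ) ⟩
    ⟦ T ++ combination form C ⟧ x ρ           ≡⟨ sym (⟦rename⟧ f (T ++ combination form C) x ρ inv) ⟩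
    ⟦ rename f (T ++ combination form C) ⟧ x ρ ≡⟨ ⟦vanishing⟧ (rename f (T ++ combination form C))
                                                               x ρ vanishes ⟩
    0ℤ                                        ∎
    where open ≡-Reasoning

-- The recurrence for the diagonal

data Series : Set where
  ‵S ‵S² ‵δ : Series

_≟ˢ_ : DecidableEquality Series
‵S  ≟ˢ ‵S  = yes refl
‵S² ≟ˢ ‵S² = yes refl
‵δ  ≟ˢ ‵δ  = yes refl
‵S  ≟ˢ ‵S² = no λ ()
‵S  ≟ˢ ‵δ  = no λ ()
‵S² ≟ˢ ‵S  = no λ ()
‵S² ≟ˢ ‵δ  = no λ ()
‵δ  ≟ˢ ‵S  = no λ ()
‵δ  ≟ˢ ‵S² = no λ ()

grid : Series → Grid
grid ‵S  = S
grid ‵S² = S²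
grid ‵δ  = δ

grid-symmetric : ∀ g → Symmetric (grid g)
grid-symmetric ‵S  = S-symmetric
grid-symmetric ‵S² = S²-symmetric
grid-symmetric ‵δ  = δ-symmetric

infixl 8 _↓_
_↓_ : ℤ → ℕ → ℤ
n ↓ zero  = n
n ↓ suc a = pred (n ↓ a)

↓≡- : ∀ n a → n ↓ a ≡ n - + a
↓≡- n zero    = sym (ℤ.+-identityʳ n)
↓≡- n (suc a) = trans (cong pred (↓≡- n a)) (shift n (+ a))
  where
  shift : ∀ n a → -1ℤ + (n - a) ≡ n - (+ 1 + a)
  shift = solve-∀

-- The atom (g , a , b , c) stands for the coefficient of the series g at (n - a, n - b, n - c).
Atom : Set
Atom = Series × ℕ × ℕ × ℕ

_≟ᵃ_ : DecidableEquality Atom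
_≟ᵃ_ = ≡-dec _≟ˢ_ (≡-dec ℕ._≟_ (≡-dec ℕ._≟_ ℕ._≟_))

value : ℤ → Atom → ℤ
value n (g , a , b , c) = grid g (n ↓ a) (n ↓ b) (n ↓ c)

-- Sorting the offsets identifies atoms that are equal by the symmetry of S, S² and δ.
sort : Atom → Atom
sort (g , a , b , c) = g , a ⊓ (b ⊓ c) , (a ⊔ (b ⊓ c)) ⊓ (b ⊔ c) , (a ⊔ (b ⊓ c)) ⊔ (b ⊔ c)

⊓⊔-invariant : ∀ {A : Set} (h : ℕ → ℕ → A) → (∀ x y → h y x ≡ h x y) →
               ∀ x y → h (x ⊓ y) (x ⊔ y) ≡ h x y
⊓⊔-invariant h comm x y with ℕ.≤-total x y
... | inj₁ x≤y rewrite ℕ.m≤n⇒m⊓n≡m x≤y | ℕ.m≤n⇒m⊔n≡n x≤y = refl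
... | inj₂ y≤x rewrite ℕ.m≥n⇒m⊓n≡n y≤x | ℕ.m≥n⇒m⊔n≡m y≤x = comm x y

value-sort : ∀ n k → value n (sort k) ≡ value n k
value-sort n (g , a , b , c) = begin
  f (a ⊓ (b ⊓ c)) ((a ⊔ (b ⊓ c)) ⊓ (b ⊔ c)) ((a ⊔ (b ⊓ c)) ⊔ (b ⊔ c))
    ≡⟨ ⊓⊔-invariant (f (a ⊓ (b ⊓ c))) (f-yz (a ⊓ (b ⊓ c))) (a ⊔ (b ⊓ c)) (b ⊔ c) ⟩
  f (a ⊓ (b ⊓ c)) (a ⊔ (b ⊓ c)) (b ⊔ c)
    ≡⟨ ⊓⊔-invariant (λ x y → f x y (b ⊔ c)) (λ x y → f-xy x y (b ⊔ c)) a (b ⊓ c) ⟩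
  f a (b ⊓ c) (b ⊔ c)
    ≡⟨ ⊓⊔-invariant (f a) (f-yz a) b c ⟩
  f a b c ∎
  where
  open ≡-Reasoning
  f : ℕ → ℕ → ℕ → ℤ
  f a b c = value n (g , a , b , c)
  f-xy : ∀ a b c → f b a c ≡ f a b c
  f-xy a b c = proj₁ (grid-symmetric g) (n ↓ a) (n ↓ b) (n ↓ c)
  f-yz : ∀ a b c → f a c b ≡ f a b c
  f-yz a b c = proj₂ (grid-symmetric g) (n ↓ a) (n ↓ b) (n ↓ c)

open LinearForms _≟ᵃ_

-- The relations Q·S = δ, Q·S² = S and x ∂S/∂x = -x (∂Q/∂x) S² at the point (n - a, n - b, n - c).
data Relation : Set where
  S-rec S²-rec euler : ℕ → ℕ → ℕ → Relation

Q-stencil : Series → ℕ → ℕ → ℕ → Form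
Q-stencil g a b c =
  ([ + 1 ] , (g , a , b , c)) ∷
  ([ - + 2 ] , (g , suc a , b , c)) ∷
  ([ - + 2 ] , (g , a , suc b , c)) ∷
  ([ - + 2 ] , (g , a , b , suc c)) ∷
  ([ + 3 ] , (g , suc a , suc b , c)) ∷
  ([ + 3 ] , (g , a , suc b , suc c)) ∷
  ([ + 3 ] , (g , suc a , b , suc c)) ∷
  []

form : Relation → Form
form (S-rec a b c)  = Q-stencil ‵S a b c ++ [ [ - + 1 ] , (‵δ , a , b , c) ]
form (S²-rec a b c) = Q-stencil ‵S² a b c ++ [ [ - + 1 ] , (‵S , a , b , c) ]
form (euler a b c)  =
  (- + a ∷ + 1 ∷ [] , (‵S , a , b , c)) ∷
  ([ - + 2 ] , (‵S² , suc a , b , c)) ∷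
  ([ + 3 ] , (‵S² , suc a , suc b , c)) ∷
  ([ + 3 ] , (‵S² , suc a , b , suc c)) ∷
  []

Q-relation-valid : ∀ n g h a b c → (Q· grid g) ≐ grid h →
  ⟦ Q-stencil g a b c ++ [ [ - + 1 ] , (h , a , b , c) ] ⟧ n (value n) ≡ 0ℤ
Q-relation-valid n g h a b c eq = trans
  (stencil-value n (F x y z) (F (pred x) y z) (F x (pred y) z) (F x y (pred z))
    (F (pred x) (pred y) z) (F x (pred y) (pred z)) (F (pred x) y (pred z)) (grid h x y z))
  (ℤ.i≡j⇒i-j≡0 (eq x y z))
  where
  F = grid g
  x = n ↓ a
  y = n ↓ b
  z = n ↓ c
  stencil-value : ∀ n f f₁ f₂ f₃ f₄ f₅ f₆ e → let c = λ k → k + n * 0ℤ in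
    c (+ 1) * f + (c (- + 2) * f₁ + (c (- + 2) * f₂ + (c (- + 2) * f₃ +
      (c (+ 3) * f₄ + (c (+ 3) * f₅ + (c (+ 3) * f₆ + (c (- + 1) * e + 0ℤ)))))))
      ≡ f - + 2 * (f₁ + f₂ + f₃) + + 3 * (f₄ + f₅ + f₆) - e
  stencil-value = solve-∀

euler-valid : ∀ n a b c → ⟦ form (euler a b c) ⟧ n (value n) ≡ 0ℤ
euler-valid n a b c = begin
  ⟦ form (euler a b c) ⟧ n (value n)
    ≡⟨ euler-value n (+ a) (S x y z) (S² (pred x) y z) (S² (pred x) (pred y) z) (S² (pred x) y (pred z)) ⟩
  (n - + a) * S x y z - (-xQₓ· S²) x y z
    ≡⟨ cong (λ e → e * S x y z - (-xQₓ· S²) x y z) (sym (↓≡- n a)) ⟩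
  (x∂ₓ S) x y z - (-xQₓ· S²) x y z
    ≡⟨ ℤ.i≡j⇒i-j≡0 (x∂ₓS≐-xQₓ·S² x y z) ⟩
  0ℤ ∎
  where
  open ≡-Reasoning
  x = n ↓ a
  y = n ↓ b
  z = n ↓ c
  euler-value : ∀ n a f u v w →
    (- a + n * (+ 1 + n * 0ℤ)) * f
      + ((- + 2 + n * 0ℤ) * u + ((+ 3 + n * 0ℤ) * v + ((+ 3 + n * 0ℤ) * w + 0ℤ)))
      ≡ (n - a) * f - (+ 2 * u - + 3 * (v + w))
  euler-value = solve-∀

form-valid : ∀ n r → ⟦ form r ⟧ n (value n) ≡ 0ℤ
form-valid n (S-rec a b c)  = Q-relation-valid n ‵S ‵δ a b c Q·S≐δ
form-valid n (S²-rec a b c) = Q-relation-valid n ‵S² ‵S a b c Q·S²≐S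
form-valid n (euler a b c)  = euler-valid n a b c

-- 2n² s(n) - 3(27n² - 27n + 8) s(n-1) + 81(3n-2)(3n-4) s(n-2) + 18(n-1) δ(n-1,n-1,n-1),
-- whose last term is always 0.
diagonal-recurrence : Form
diagonal-recurrence =
  (+ 0 ∷ + 0 ∷ + 2 ∷ [] , (‵S , 0 , 0 , 0)) ∷
  (- + 24 ∷ + 81 ∷ - + 81 ∷ [] , (‵S , 1 , 1 , 1)) ∷
  (+ 648 ∷ - + 1458 ∷ + 729 ∷ [] , (‵S , 2 , 2 , 2)) ∷
  (- + 18 ∷ + 18 ∷ [] , (‵δ , 1 , 1 , 1)) ∷
  []

-- Found by creative telescoping.
certificate : List (Poly × Relation)
certificate =
  (- + 18 ∷ + 18 ∷ [] , S-rec 1 1 1) ∷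
  (+ 0 ∷ - + 4 ∷ [] , S²-rec 0 0 1) ∷
  (+ 0 ∷ - + 12 ∷ [] , S²-rec 0 1 1) ∷
  (+ 0 ∷ + 54 ∷ [] , S²-rec 0 2 2) ∷
  (+ 12 ∷ - + 36 ∷ [] , S²-rec 1 1 1) ∷
  (+ 0 ∷ + 162 ∷ [] , S²-rec 1 2 2) ∷
  (- + 324 ∷ + 486 ∷ [] , S²-rec 2 2 2) ∷
  (+ 0 ∷ - + 2 ∷ [] , euler 0 0 0) ∷
  (+ 0 ∷ - + 4 ∷ [] , euler 0 0 1) ∷
  (+ 6 ∷ - + 18 ∷ [] , euler 0 1 1) ∷
  (+ 36 ∷ - + 36 ∷ [] , euler 0 1 2) ∷
  (- + 54 ∷ + 54 ∷ [] , euler 0 2 2) ∷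
  (+ 0 ∷ + 4 ∷ [] , euler 1 0 0) ∷
  (+ 0 ∷ + 18 ∷ [] , euler 1 0 1) ∷
  (+ 0 ∷ + 36 ∷ [] , euler 1 0 2) ∷
  (- + 54 ∷ + 81 ∷ [] , euler 1 1 1) ∷
  (+ 0 ∷ + 54 ∷ [] , euler 1 1 2) ∷
  (- + 162 ∷ + 162 ∷ [] , euler 1 2 2) ∷
  (+ 0 ∷ - + 54 ∷ [] , euler 2 0 2) ∷
  (+ 54 ∷ - + 54 ∷ [] , euler 2 1 1) ∷
  (+ 0 ∷ - + 162 ∷ [] , euler 2 1 2) ∷
  (+ 486 ∷ - + 729 ∷ [] , euler 2 2 2) ∷
  []

certificate-vanishes : Vanishes (rename sort (diagonal-recurrence ++ combination form certificate))
certificate-vanishes =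
  from-yes (vanishes? (rename sort (diagonal-recurrence ++ combination form certificate)))

diagonal-recurrence-holds : ∀ n → ⟦ diagonal-recurrence ⟧ n (value n) ≡ 0ℤ
diagonal-recurrence-holds n =
  certified form diagonal-recurrence certificate sort n (value n) (value-sort n) (form-valid n)
            certificate-vanishes

s-recurrence : ∀ m → let n = + (2 ℕ.+ m) in
  + 2 * (n * n) * s (2 ℕ.+ m)
    ≡ + 3 * (+ 27 * (n * n) - + 27 * n + + 8) * s (1 ℕ.+ m)
      - + 81 * ((+ 3 * n - + 2) * (+ 3 * n - + 4)) * s m
s-recurrence m =
  ℤ.i-j≡0⇒i≡j _ _ (trans (sym (evaluate (+ m) (s m) (s (1 ℕ.+ m)) (s (2 ℕ.+ m))))
                          (diagonal-recurrence-holds (+ (2 ℕ.+ m))))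
  where
  evaluate : ∀ x s₀ s₁ s₂ → let n = + 2 + x in
    (+ 0 + n * (+ 0 + n * (+ 2 + n * 0ℤ))) * s₂ + ((- + 24 + n * (+ 81 + n * (- + 81 + n * 0ℤ))) * s₁ +
      ((+ 648 + n * (- + 1458 + n * (+ 729 + n * 0ℤ))) * s₀ + ((- + 18 + n * (+ 18 + n * 0ℤ)) * 0ℤ + 0ℤ)))
      ≡ + 2 * (n * n) * s₂
        - (+ 3 * (+ 27 * (n * n) - + 27 * n + + 8) * s₁ - + 81 * ((+ 3 * n - + 2) * (+ 3 * n - + 4)) * s₀)
  evaluate = solve-∀

-- Positivity

-- gap n ≥ 0 means s (n + 1) ≥ 27/2 · s n; since gap 0 = -3, the induction starts at n = 1.
gap : ℕ → ℤ
gap n = + 2 * s (suc n) - + 27 * s n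

gap-recurrence : ∀ n →
  + ((3 ℕ.+ n) ℕ.* (3 ℕ.+ n)) * gap (2 ℕ.+ n)
    ≡ + (27 ℕ.* n ℕ.+ 57) * s (2 ℕ.+ n) + + (3 ℕ.* (3 ℕ.* n ℕ.+ 7) ℕ.* (3 ℕ.* n ℕ.+ 5)) * gap (1 ℕ.+ n)
gap-recurrence n = begin
  + ((3 ℕ.+ n) ℕ.* (3 ℕ.+ n)) * gap (2 ℕ.+ n)
    ≡⟨ cong (_* gap (2 ℕ.+ n)) (ℤ.pos-* (3 ℕ.+ n) (3 ℕ.+ n)) ⟩
  + (3 ℕ.+ n) * + (3 ℕ.+ n) * gap (2 ℕ.+ n)
    ≡⟨ drop-zero (regroup (+ n) (s (1 ℕ.+ n)) (s (2 ℕ.+ n)) (s (3 ℕ.+ n)))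
                 (ℤ.i≡j⇒i-j≡0 (s-recurrence (suc n))) ⟩
  (+ 27 * + n + + 57) * s (2 ℕ.+ n) + + 3 * (+ 3 * + n + + 7) * (+ 3 * + n + + 5) * gap (1 ℕ.+ n)
    ≡⟨ cong₂ (λ a b → a * s (2 ℕ.+ n) + b * gap (1 ℕ.+ n)) (sym A≡) (sym B≡) ⟩
  + (27 ℕ.* n ℕ.+ 57) * s (2 ℕ.+ n) + + (3 ℕ.* (3 ℕ.* n ℕ.+ 7) ℕ.* (3 ℕ.* n ℕ.+ 5)) * gap (1 ℕ.+ n) ∎
  where
  open ≡-Reasoning
  drop-zero : ∀ {l r e} → l ≡ r + e → e ≡ 0ℤ → l ≡ r
  drop-zero eq refl = trans eq (ℤ.+-identityʳ _)
  regroup : ∀ x s₁ s₂ s₃ → let n = + 3 + x in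
    n * n * (+ 2 * s₃ - + 27 * s₂)
      ≡ (+ 27 * x + + 57) * s₂ + + 3 * (+ 3 * x + + 7) * (+ 3 * x + + 5) * (+ 2 * s₂ - + 27 * s₁)
        + (+ 2 * (n * n) * s₃
           - (+ 3 * (+ 27 * (n * n) - + 27 * n + + 8) * s₂ - + 81 * ((+ 3 * n - + 2) * (+ 3 * n - + 4)) * s₁))
  regroup = solve-∀
  linear : ∀ a b → + (a ℕ.* n ℕ.+ b) ≡ + a * + n + + b
  linear a b = cong (λ e → e + + b) (ℤ.pos-* a n)
  A≡ : + (27 ℕ.* n ℕ.+ 57) ≡ + 27 * + n + + 57
  A≡ = linear 27 57
  B≡ : + (3 ℕ.* (3 ℕ.* n ℕ.+ 7) ℕ.* (3 ℕ.* n ℕ.+ 5)) ≡ + 3 * (+ 3 * + n + + 7) * (+ 3 * + n + + 5)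
  B≡ = trans (ℤ.pos-* (3 ℕ.* (3 ℕ.* n ℕ.+ 7)) (3 ℕ.* n ℕ.+ 5))
             (cong₂ _*_ (trans (ℤ.pos-* 3 (3 ℕ.* n ℕ.+ 7)) (cong (λ e → + 3 * e) (linear 3 7))) (linear 3 5))

private
  0≤-combination : ∀ a b {x y} → 0ℤ ≤ x → 0ℤ ≤ y → 0ℤ ≤ + a * x + + b * y
  0≤-combination a b (+≤+ {n = p} _) (+≤+ {n = q} _) =
    subst (0ℤ ≤_) (cong₂ _+_ (ℤ.pos-* a p) (ℤ.pos-* b q)) (+≤+ z≤n)

  0≤-cancel : ∀ k {x} → 0ℤ < k → 0ℤ ≤ k * x → 0ℤ ≤ x
  0≤-cancel k          {+ _}       _        _  = +≤+ z≤n
  0≤-cancel (+ suc _)  { -[1+ _ ]} _        ()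
  0≤-cancel (+ zero)   { -[1+ _ ]} (+<+ ()) _
  0≤-cancel -[1+ _ ]   { -[1+ _ ]} ()       _

  0<-step : ∀ {x y} → 0ℤ ≤ + 2 * x - + 27 * y → 0ℤ < y → 0ℤ < x
  0<-step {+ suc _}   {_}         _  _        = +<+ z<s
  0<-step {+ zero}    {+ suc _}   () _
  0<-step { -[1+ _ ]} {+ suc _}   () _
  0<-step {+ zero}    {+ zero}    _  (+<+ ())
  0<-step { -[1+ _ ]} {+ zero}    _  (+<+ ())
  0<-step {_}         { -[1+ _ ]} _  ()

positive-and-growing : ∀ n → 0ℤ < s (suc n) × 0ℤ ≤ gap (suc n)
positive-and-growing zero    = +<+ z<s , +≤+ z≤n
positive-and-growing (suc n) =
  s>0 , 0≤-cancel (+ ((3 ℕ.+ n) ℕ.* (3 ℕ.+ n))) (+<+ z<s) (subst (0ℤ ≤_) (sym (gap-recurrence n))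
          (0≤-combination (27 ℕ.* n ℕ.+ 57) (3 ℕ.* (3 ℕ.* n ℕ.+ 7) ℕ.* (3 ℕ.* n ℕ.+ 5))
                          (ℤ.<⇒≤ s>0) gap≥0))
  where
  gap≥0 = proj₂ (positive-and-growing n)
  s>0 = 0<-step gap≥0 (proj₁ (positive-and-growing n))

lemma1 : (n : ℕ) → + 0 < s n
lemma1 zero    = +<+ z<s
lemma1 (suc n) = proj₁ (positive-and-growing n)
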